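{- For every integer $n\ge 3$, the number of $1$-Lipschitz mappings of the cycle $C_n$ is $|\mathcal{L}_1(C_n)| = \binom{n}{0}_2$, the $n$-th central trinomial coefficient.
   Context: Trinomial coefficients $\binom{n}{k}_2$ ($n\ge 0$, $k\in\mathbb{Z}$) are defined by $\binom{0}{0}_2=1$, $\binom{0}{k}_2=0$ for $k\ne 0$, and $\binom{n+1}{k}_2=\binom{n}{k-1}_2+\binom{n}{k}_2+\binom{n}{k+1}_2$; equivalently $\binom{n}{k}_2$ is the coefficient of $x^k$ in $(x^{ -1}+1+x)^n$. Let $G=(V,E)$ be a finite connected graph with a fixed root $v_0$. A $1$-Lipschitz mapping of $G$ is a map $f:V\to\mathbb{Z}$ with $f(v_0)=0$ and $|f(u)-f(v)|\le 1$ for every edge $uv$; $\mathcal{L}_1(G)$ is the set of these. -}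

module Defs where

open import Data.Nat using (ℕ; zero; suc; _+_)
open import Data.Integer using (ℤ; +_; -[1+_]; _-_; ∣_∣) renaming (_+_ to _+ℤ_)
open import Data.Fin using (Fin; zero; suc; toℕ)
open import Data.Vec using (Vec; lookup)
open import Data.Product using (Σ; _×_; proj₁)
open import Relation.Binary.PropositionalEquality using (_≡_)
import Data.Nat as ℕ

-- Trinomial coefficients  (n choose k)_2 : coefficient of x^k in (x⁻¹ + 1 + x)^n,
-- defined by the recursion of the paper, with k ∈ ℤ.
trinomial : ℕ → ℤ → ℕ
trinomial zero (+ zero) = 1
trinomial zero _ = 0
trinomial (suc n) k = trinomial n (k - + 1) + trinomial n k + trinomial n (k +ℤ + 1)

record Graph (n : ℕ) : Set₁ where
  field
    Adj  : Fin n → Fin n → Set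
    root : Fin n

-- The cycle C_{m+1} on vertices 0,1,…,m (edges i ~ i+1 mod n), rooted at 0.
-- Two vertices are adjacent iff their indices differ by 1 modulo m+1.
cycleGraph : (m : ℕ) → Graph (suc m)
cycleGraph n = record
  { Adj  = λ i j → (suc (toℕ i) ℕ.% suc n ≡ toℕ j) Data.Sum.⊎ (suc (toℕ j) ℕ.% suc n ≡ toℕ i)
  ; root = zero
  }
  where import Data.Sum

IsLipschitz1 : ∀ {n} → Graph n → Vec ℤ n → Set
IsLipschitz1 {n} G f =
  (lookup f (Graph.root G) ≡ + 0) ×
  (∀ (u v : Fin n) → Graph.Adj G u v → ∣ lookup f u - lookup f v ∣ ℕ.≤ 1)

L₁ : ∀ {n} → Graph n → Set
L₁ {n} G = Σ (Vec ℤ n) (IsLipschitz1 G)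

_HasCard_ : ∀ {n} → Graph n → ℕ → Set
_HasCard_ {n} G N = Σ (Fin N → L₁ G) λ e →
  (∀ i j → proj₁ (e i) ≡ proj₁ (e j) → i ≡ j) ×
  (∀ (f : L₁ G) → Σ (Fin N) λ i → proj₁ (e i) ≡ proj₁ f)

-- A 1-Lipschitz map f of C_{m+1} with f(0) = 0 is the same thing as a closed walk
-- 0 = f(0), f(1), …, f(m), 0 in ℤ of length m+1 with steps in {-1, 0, 1}. Splitting off
-- the first step shows that such walks of length n from a to b satisfy the defining
-- recursion of the trinomial coefficients, so there are (n choose b - a)₂ of them.

module Submission where

open import Defs
open import Data.Nat using (ℕ; _≥_; suc; zero; s≤s; z≤n)
import Data.Nat as ℕ
open import Data.Nat.DivMod using (_%_; n%n≡0; m<n⇒m%n≡m)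
open import Data.Integer using (ℤ; +_; -[1+_]; _+_; _-_; -_; ∣_∣)
import Data.Integer as ℤ
open import Data.Integer.Properties
  using (+-0-abelianGroup; +-inverseʳ; i-j≡0⇒i≡j; ∣i-j∣≡∣j-i∣; ∣-i∣≡∣i∣)
open import Algebra.Properties.AbelianGroup +-0-abelianGroup using (∙-cancelˡ)
open import Data.Integer.Tactic.RingSolver using (solve-∀)
open import Data.Fin using (Fin; zero; suc; toℕ; fromℕ; inject₁; splitAt; join)
open import Data.Fin.Properties
  using (toℕ-injective; toℕ-inject₁; toℕ-fromℕ; toℕ<n; splitAt-join; join-splitAt)
open import Data.Vec using (Vec; []; _∷_; _∷ʳ_; lookup; head; tail; init; last; initLast)
open import Data.Vec.Properties using (init-∷ʳ; last-∷ʳ)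
open import Data.Vec.Relation.Unary.Linked using (Linked; [-]; _∷_)
open import Data.Product using (Σ; _×_; _,_; proj₁; proj₂)
open import Data.Sum using (_⊎_; inj₁; inj₂)
open import Data.Empty using (⊥; ⊥-elim)
open import Function using (_⇔_; mk⇔; Equivalence; id; _∘_)
open import Relation.Nullary using (yes; no; ¬_)
open import Relation.Binary.PropositionalEquality

open Equivalence using (to; from)

-- G HasCard N unfolds to Card (IsLipschitz1 G) N.
Card : {A : Set} → (A → Set) → ℕ → Set
Card {A} P N = Σ (Fin N → Σ A P) λ e →
  (∀ i j → proj₁ (e i) ≡ proj₁ (e j) → i ≡ j) ×
  (∀ (x : Σ A P) → Σ (Fin N) λ i → proj₁ (e i) ≡ proj₁ x)

module _ {A B : Set} {P : A → Set} {Q : B → Set} {N : ℕ} where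

  Card-transport : (g : A → B) (h : B → A) →
    (∀ {x} → P x → Q (g x)) → (∀ {y} → Q y → P (h y)) →
    (∀ {x} → P x → h (g x) ≡ x) → (∀ {y} → Q y → g (h y) ≡ y) →
    Card P N → Card Q N
  Card-transport g h P⇒Q Q⇒P hg≡id gh≡id (e , e-inj , e-surj) = e′ , e′-inj , e′-surj
    where
    e′ : Fin N → Σ B Q
    e′ i = g (proj₁ (e i)) , P⇒Q (proj₂ (e i))
    e′-inj : ∀ i j → proj₁ (e′ i) ≡ proj₁ (e′ j) → i ≡ j
    e′-inj i j eq = e-inj i j (begin
      proj₁ (e i)          ≡⟨ sym (hg≡id (proj₂ (e i))) ⟩
      h (g (proj₁ (e i)))  ≡⟨ cong h eq ⟩
      h (g (proj₁ (e j)))  ≡⟨ hg≡id (proj₂ (e j)) ⟩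
      proj₁ (e j)          ∎)
      where open ≡-Reasoning
    e′-surj : ∀ (y : Σ B Q) → Σ (Fin N) λ i → proj₁ (e′ i) ≡ proj₁ y
    e′-surj (y , qy) with e-surj (h y , Q⇒P qy)
    ... | i , eq = i , trans (cong g eq) (gh≡id qy)

module _ {A : Set} {P Q : A → Set} {N : ℕ} where

  Card-cong : (∀ {x} → P x → Q x) → (∀ {x} → Q x → P x) → Card P N → Card Q N
  Card-cong P⇒Q Q⇒P = Card-transport id id P⇒Q Q⇒P (λ _ → refl) (λ _ → refl)

module _ {A : Set} {P : A → Set} where

  Card-∅ : (∀ {x} → ¬ P x) → Card P 0
  Card-∅ ¬P = (λ ()) , (λ ()) , λ (_ , px) → ⊥-elim (¬P px)

  Card-singleton : (a : A) → P a → (∀ {x} → P x → x ≡ a) → Card P 1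
  Card-singleton a pa unique =
    (λ _ → a , pa) , (λ { zero zero _ → refl }) , λ (_ , px) → zero , sym (unique px)

module _ {A : Set} {P Q : A → Set} {N M : ℕ} where

  Card-⊎ : Card P N → Card Q M → (∀ {x} → P x → Q x → ⊥) →
    Card (λ x → P x ⊎ Q x) (N ℕ.+ M)
  Card-⊎ (eP , eP-inj , eP-surj) (eQ , eQ-inj , eQ-surj) disjoint =
    e∘split , e∘split-inj , e∘split-surj
    where
    e : Fin N ⊎ Fin M → Σ A λ x → P x ⊎ Q x
    e (inj₁ i) = proj₁ (eP i) , inj₁ (proj₂ (eP i))
    e (inj₂ j) = proj₁ (eQ j) , inj₂ (proj₂ (eQ j))
    e-inj : ∀ s t → proj₁ (e s) ≡ proj₁ (e t) → s ≡ t
    e-inj (inj₁ i) (inj₁ j) eq = cong inj₁ (eP-inj i j eq)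
    e-inj (inj₁ i) (inj₂ j) eq = ⊥-elim (disjoint (proj₂ (eP i)) (subst Q (sym eq) (proj₂ (eQ j))))
    e-inj (inj₂ i) (inj₁ j) eq = ⊥-elim (disjoint (proj₂ (eP j)) (subst Q eq (proj₂ (eQ i))))
    e-inj (inj₂ i) (inj₂ j) eq = cong inj₂ (eQ-inj i j eq)
    e∘split : Fin (N ℕ.+ M) → Σ A λ x → P x ⊎ Q x
    e∘split i = e (splitAt N i)
    e∘split-inj : ∀ i j → proj₁ (e∘split i) ≡ proj₁ (e∘split j) → i ≡ j
    e∘split-inj i j eq = begin
      i                     ≡⟨ join-splitAt N M i ⟨
      join N M (splitAt N i) ≡⟨ cong (join N M) (e-inj (splitAt N i) (splitAt N j) eq) ⟩
      join N M (splitAt N j) ≡⟨ join-splitAt N M j ⟩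
      j                     ∎
      where open ≡-Reasoning
    hit : ∀ s {x} → proj₁ (e s) ≡ x → Σ (Fin (N ℕ.+ M)) λ i → proj₁ (e∘split i) ≡ x
    hit s eq = join N M s , trans (cong (λ t → proj₁ (e t)) (splitAt-join N M s)) eq
    e∘split-surj : ∀ (x : Σ A λ x → P x ⊎ Q x) → Σ (Fin (N ℕ.+ M)) λ i → proj₁ (e∘split i) ≡ proj₁ x
    e∘split-surj (x , inj₁ px) = let i , eq = eP-surj (x , px) in hit (inj₁ i) eq
    e∘split-surj (x , inj₂ qx) = let j , eq = eQ-surj (x , qx) in hit (inj₂ j) eq

module _ {A : Set} {k N : ℕ} {P : Vec A k → Set} where

  Card-∷ : (a : A) → Card P N → Card (λ (v : Vec A (suc k)) → head v ≡ a × P (tail v)) N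
  Card-∷ a (e , e-inj , e-surj) =
    (λ i → (a ∷ proj₁ (e i)) , refl , proj₂ (e i)) ,
    (λ i j eq → e-inj i j (cong tail eq)) ,
    λ { ((x ∷ w) , x≡a , pw) → let i , eq = e-surj (w , pw) in i , cong₂ _∷_ (sym x≡a) eq }

j≡i-[i-j] : ∀ i j → j ≡ i - (i - j)
j≡i-[i-j] = solve-∀

i-[i+j]≡-j : ∀ i j → i - (i + j) ≡ - j
i-[i+j]≡-j = solve-∀

k-[i+1]≡k-i-1 : ∀ i k → k - (i + + 1) ≡ (k - i) - + 1
k-[i+1]≡k-i-1 = solve-∀

k-[i+0]≡k-i : ∀ i k → k - (i + + 0) ≡ k - i
k-[i+0]≡k-i = solve-∀

k-[i-1]≡k-i+1 : ∀ i k → k - (i + -[1+ 0 ]) ≡ (k - i) + + 1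
k-[i-1]≡k-i+1 = solve-∀

Step : ℤ → ℤ → Set
Step x y = ∣ x - y ∣ ℕ.≤ 1

Step-sym : ∀ {x y} → Step x y → Step y x
Step-sym {x} {y} = subst (ℕ._≤ 1) (∣i-j∣≡∣j-i∣ x y)

-- The middle neighbour is written a + + 0 so that all three have the shape a + d
-- and are told apart by cancelling a.
Neighbour : ℤ → ℤ → Set
Neighbour a y = (y ≡ a + + 1 ⊎ y ≡ a + + 0) ⊎ y ≡ a + -[1+ 0 ]

Step-+ : ∀ a {d} → ∣ d ∣ ℕ.≤ 1 → Step a (a + d)
Step-+ a {d} = subst (ℕ._≤ 1) (trans (sym (∣-i∣≡∣i∣ d)) (cong ∣_∣ (sym (i-[i+j]≡-j a d))))

Step⇒Neighbour : ∀ a {y} → Step a y → Neighbour a y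
Step⇒Neighbour a {y} = classify (a - y) (j≡i-[i-j] a y)
  where
  classify : ∀ k → y ≡ a + - k → ∣ k ∣ ℕ.≤ 1 → Neighbour a y
  classify (+ 0)           e _ = inj₁ (inj₂ e)
  classify (+ 1)           e _ = inj₂ e
  classify (+ suc (suc _)) _ (s≤s ())
  classify -[1+ 0 ]        e _ = inj₁ (inj₁ e)
  classify -[1+ suc _ ]    _ (s≤s ())

Neighbour⇒Step : ∀ a {y} → Neighbour a y → Step a y
Neighbour⇒Step a (inj₁ (inj₁ refl)) = Step-+ a (s≤s z≤n)
Neighbour⇒Step a (inj₁ (inj₂ refl)) = Step-+ a z≤n
Neighbour⇒Step a (inj₂ refl)        = Step-+ a (s≤s z≤n)

Walk : ∀ n → ℤ → ℤ → Vec ℤ (suc n) → Set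
Walk n a b v = head v ≡ a × last v ≡ b × Linked Step v

Walk-starts-≢ : ∀ {n} a {b d d′} {v : Vec ℤ (suc n)} → d ≢ d′ →
  Walk n (a + d) b v → Walk n (a + d′) b v → ⊥
Walk-starts-≢ a {d = d} {d′} d≢d′ (start , _) (start′ , _) =
  d≢d′ (∙-cancelˡ a d d′ (trans (sym start) start′))

NextWalk : ∀ n → ℤ → ℤ → Vec ℤ (suc n) → Set
NextWalk n a b w =
  (Walk n (a + + 1) b w ⊎ Walk n (a + + 0) b w) ⊎ Walk n (a + -[1+ 0 ]) b w

Walk-suc⇔ : ∀ {n a b} (v : Vec ℤ (suc (suc n))) →
  Walk (suc n) a b v ⇔ (head v ≡ a × NextWalk n a b (tail v))
Walk-suc⇔ {n} {a} {b} (x ∷ y ∷ w) = mk⇔ split glue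
  where
  split : Walk (suc n) a b (x ∷ y ∷ w) → head (x ∷ y ∷ w) ≡ a × NextWalk n a b (y ∷ w)
  split (refl , end , step ∷ linked) with Step⇒Neighbour a step
  ... | inj₁ (inj₁ e) = refl , inj₁ (inj₁ (e , end , linked))
  ... | inj₁ (inj₂ e) = refl , inj₁ (inj₂ (e , end , linked))
  ... | inj₂ e        = refl , inj₂ (e , end , linked)
  glue : head (x ∷ y ∷ w) ≡ a × NextWalk n a b (y ∷ w) → Walk (suc n) a b (x ∷ y ∷ w)
  glue (refl , inj₁ (inj₁ (e , end , linked))) = refl , end , Neighbour⇒Step a (inj₁ (inj₁ e)) ∷ linked
  glue (refl , inj₁ (inj₂ (e , end , linked))) = refl , end , Neighbour⇒Step a (inj₁ (inj₂ e)) ∷ linked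
  glue (refl , inj₂ (e , end , linked))        = refl , end , Neighbour⇒Step a (inj₂ e) ∷ linked

trinomial-zero-≢ : ∀ {k} → k ≢ + 0 → trinomial 0 k ≡ 0
trinomial-zero-≢ {+ zero}   k≢0 = ⊥-elim (k≢0 refl)
trinomial-zero-≢ {+ suc _}  _   = refl
trinomial-zero-≢ { -[1+ _ ]} _   = refl

trinomial-suc-shift : ∀ n a b →
  trinomial n (b - (a + + 1)) ℕ.+ trinomial n (b - (a + + 0)) ℕ.+ trinomial n (b - (a + -[1+ 0 ]))
    ≡ trinomial (suc n) (b - a)
trinomial-suc-shift n a b
  rewrite k-[i+1]≡k-i-1 a b | k-[i+0]≡k-i a b | k-[i-1]≡k-i+1 a b = refl

Card-Walk : ∀ n a b → Card (Walk n a b) (trinomial n (b - a))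
Card-Walk zero a b with a ℤ.≟ b
... | yes refl = subst (Card (Walk 0 a a)) (cong (trinomial 0) (sym (+-inverseʳ a)))
  (Card-singleton (a ∷ []) (refl , refl , [-]) λ { {x ∷ []} (x≡a , _) → cong (_∷ []) x≡a })
... | no a≢b = subst (Card (Walk 0 a b)) (sym (trinomial-zero-≢ (a≢b ∘ sym ∘ i-j≡0⇒i≡j b a)))
  (Card-∅ λ { {x ∷ []} (x≡a , x≡b , _) → a≢b (trans (sym x≡a) x≡b) })
Card-Walk (suc n) a b = subst (Card (Walk (suc n) a b)) (trinomial-suc-shift n a b)
  (Card-cong (from (Walk-suc⇔ _)) (to (Walk-suc⇔ _)) (Card-∷ a next))
  where
  next : Card (NextWalk n a b) _
  next = Card-⊎ (Card-⊎ (Card-Walk n _ b) (Card-Walk n _ b) (Walk-starts-≢ a λ ()))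
    (Card-Walk n _ b) λ { (inj₁ w) → Walk-starts-≢ a (λ ()) w ; (inj₂ w) → Walk-starts-≢ a (λ ()) w }

module _ {A : Set} {R : A → A → Set} where

  Linked⇒consecutive : ∀ {n} {xs : Vec A (suc n)} → Linked R xs →
    (i : Fin n) → R (lookup xs (inject₁ i)) (lookup xs (suc i))
  Linked⇒consecutive {xs = _ ∷ _ ∷ _} (r ∷ _)  zero    = r
  Linked⇒consecutive {xs = _ ∷ _ ∷ _} (_ ∷ rs) (suc i) = Linked⇒consecutive rs i

  consecutive⇒Linked : ∀ {n} {xs : Vec A (suc n)} →
    ((i : Fin n) → R (lookup xs (inject₁ i)) (lookup xs (suc i))) → Linked R xs
  consecutive⇒Linked {xs = _ ∷ []}    _ = [-]
  consecutive⇒Linked {xs = _ ∷ _ ∷ _} r = r zero ∷ consecutive⇒Linked (r ∘ suc)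

  Linked-∷ʳ⁺ : ∀ {n x} {xs : Vec A (suc n)} → Linked R xs → R (last xs) x → Linked R (xs ∷ʳ x)
  Linked-∷ʳ⁺ {xs = _ ∷ []}    [-]      r = r ∷ [-]
  Linked-∷ʳ⁺ {xs = _ ∷ _ ∷ _} (r ∷ rs) r′ = r ∷ Linked-∷ʳ⁺ rs r′

  Linked-∷ʳ⁻ : ∀ {n x} {xs : Vec A (suc n)} → Linked R (xs ∷ʳ x) → Linked R xs × R (last xs) x
  Linked-∷ʳ⁻ {xs = _ ∷ []}    (r ∷ [-]) = [-] , r
  Linked-∷ʳ⁻ {xs = _ ∷ _ ∷ _} (r ∷ rs)  = let rs′ , r′ = Linked-∷ʳ⁻ rs in r ∷ rs′ , r′

last≡lookup-fromℕ : ∀ {A : Set} {n} (xs : Vec A (suc n)) → last xs ≡ lookup xs (fromℕ n)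
last≡lookup-fromℕ (_ ∷ [])     = refl
last≡lookup-fromℕ (_ ∷ y ∷ ys) = last≡lookup-fromℕ (y ∷ ys)

init-∷ʳ-last : ∀ {A : Set} {n} (xs : Vec A (suc n)) → init xs ∷ʳ last xs ≡ xs
init-∷ʳ-last xs = sym (proj₂ (proj₂ (initLast xs)))

CycleSucc : ∀ m → Fin (suc m) → Fin (suc m) → Set
CycleSucc m u v = suc (toℕ u) % suc m ≡ toℕ v

module _ {m : ℕ} where

  CycleSucc-inject₁ : (i : Fin m) → CycleSucc m (inject₁ i) (suc i)
  CycleSucc-inject₁ i =
    trans (cong (λ k → suc k % suc m) (toℕ-inject₁ i)) (m<n⇒m%n≡m (s≤s (toℕ<n i)))

  CycleSucc-fromℕ : CycleSucc m (fromℕ m) zero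
  CycleSucc-fromℕ = trans (cong (λ k → suc k % suc m) (toℕ-fromℕ m)) (n%n≡0 (suc m))

  CycleSucc-functional : ∀ {u v w} → CycleSucc m u v → CycleSucc m u w → v ≡ w
  CycleSucc-functional u↦v u↦w = toℕ-injective (trans (sym u↦v) u↦w)

inject₁-or-fromℕ : ∀ {m} (u : Fin (suc m)) → (Σ (Fin m) λ i → inject₁ i ≡ u) ⊎ fromℕ m ≡ u
inject₁-or-fromℕ {zero}  zero    = inj₂ refl
inject₁-or-fromℕ {suc m} zero    = inj₁ (zero , refl)
inject₁-or-fromℕ {suc m} (suc u) with inject₁-or-fromℕ u
... | inj₁ (i , refl) = inj₁ (suc i , refl)
... | inj₂ refl       = inj₂ refl

module _ {A : Set} {R : A → A → Set} {m : ℕ} where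

  along-cycle⇔Linked-closed : (f : Vec A (suc m)) →
    (∀ u v → CycleSucc m u v → R (lookup f u) (lookup f v)) ⇔ Linked R (f ∷ʳ head f)
  along-cycle⇔Linked-closed f@(x ∷ _) = mk⇔ closed-Linked along-cycle
    where
    closed-Linked : (∀ u v → CycleSucc m u v → R (lookup f u) (lookup f v)) → Linked R (f ∷ʳ x)
    closed-Linked along = Linked-∷ʳ⁺
      (consecutive⇒Linked {xs = f} λ i → along (inject₁ i) (suc i) (CycleSucc-inject₁ i))
      (subst (λ y → R y x) (sym (last≡lookup-fromℕ f)) (along (fromℕ m) zero (CycleSucc-fromℕ {m})))
    along-cycle : Linked R (f ∷ʳ x) → ∀ u v → CycleSucc m u v → R (lookup f u) (lookup f v)
    along-cycle linked u v u↦v with Linked-∷ʳ⁻ {xs = f} linked | inject₁-or-fromℕ u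
    ... | path , _ | inj₁ (i , refl) = subst (λ w → R (lookup f (inject₁ i)) (lookup f w))
      (CycleSucc-functional (CycleSucc-inject₁ i) u↦v) (Linked⇒consecutive path i)
    ... | _ , closing | inj₂ refl = subst₂ (λ y w → R y (lookup f w))
      (last≡lookup-fromℕ f) (CycleSucc-functional (CycleSucc-fromℕ {m}) u↦v) closing

Lipschitz⇔closed-Walk : ∀ {m} (f : Vec ℤ (suc m)) →
  IsLipschitz1 (cycleGraph m) f ⇔ Walk (suc m) (+ 0) (+ 0) (f ∷ʳ + 0)
Lipschitz⇔closed-Walk {m} f@(_ ∷ _) = mk⇔ to′ from′
  where
  to′ : IsLipschitz1 (cycleGraph m) f → Walk (suc m) (+ 0) (+ 0) (f ∷ʳ + 0)
  to′ (refl , lipschitz) = refl , last-∷ʳ (+ 0) f ,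
    to (along-cycle⇔Linked-closed f) λ u v u↦v → lipschitz u v (inj₁ u↦v)
  from′ : Walk (suc m) (+ 0) (+ 0) (f ∷ʳ + 0) → IsLipschitz1 (cycleGraph m) f
  from′ (refl , _ , linked) = refl , λ
    { u v (inj₁ u↦v) → along linked u v u↦v
    ; u v (inj₂ v↦u) → Step-sym {lookup f v} (along linked v u v↦u) }
    where
    along : Linked Step (f ∷ʳ + 0) → ∀ u v → CycleSucc m u v → Step (lookup f u) (lookup f v)
    along = from (along-cycle⇔Linked-closed f)

Walk-init-∷ʳ : ∀ {n a b} {v : Vec ℤ (suc (suc n))} → Walk (suc n) a b v → init v ∷ʳ b ≡ v
Walk-init-∷ʳ {v = v} (_ , end , _) = subst (λ y → init v ∷ʳ y ≡ v) end (init-∷ʳ-last v)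

theorem7 : (m : ℕ) → suc m ≥ 3 →
    cycleGraph m HasCard trinomial (suc m) (+ 0)
theorem7 m _ = Card-transport init (_∷ʳ + 0)
  (λ walk → from (Lipschitz⇔closed-Walk _) (subst (Walk (suc m) (+ 0) (+ 0)) (sym (Walk-init-∷ʳ walk)) walk))
  (to (Lipschitz⇔closed-Walk _))
  Walk-init-∷ʳ
  (λ {f} _ → init-∷ʳ (+ 0) f)
  (Card-Walk (suc m) (+ 0) (+ 0))
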